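{- For all sequences $\overline{z_1},\overline{z_2},\overline{w}\in\mathsf{seq}$: if $\mathsf{red}(\overline{z_1}\overline{w})=\mathsf{red}(\overline{z_2}\overline{w})$, then $\mathsf{red}(\overline{z_1}\overline{y})=\mathsf{red}(\overline{z_2}\overline{y})$ for every $\overline{y}\in\mathsf{seq}$.
   Context: $\mathsf{seq}$ is the set of finite sequences over $\{l,r,\lambda,\rho,n\}$, juxtaposition = concatenation. One-step reduction $\rightsquigarrow'$ is generated by: $\overline{x}l\lambda\overline{y}\rightsquigarrow'\overline{x}\rho\overline{y}$; $\overline{x}r\lambda\overline{y}\rightsquigarrow'\overline{x}\overline{y}$; $\overline{x}\lambda r\overline{y}\rightsquigarrow'\overline{x}\overline{y}$; $\overline{x}\rho r\overline{y}\rightsquigarrow'\overline{x}l\overline{y}$; $\overline{x}nn\overline{y}\rightsquigarrow'\overline{x}\overline{y}$. A sequence is reduced if no step applies. $\rightsquigarrow$ is the reflexive-transitive closure of $\rightsquigarrow'$; $\mathsf{red}(\overline{z})$ is the unique reduced sequence with $\overline{z}\rightsquigarrow\mathsf{red}(\overline{z})$. -}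

module Defs where

open import Data.List using (List; []; _∷_; _++_)
open import Relation.Binary.Construct.Closure.ReflexiveTransitive using (Star)
open import Relation.Nullary using (¬_)
open import Data.Product using (_×_)

data Sym : Set where
  l r lam rho n : Sym

Seq : Set
Seq = List Sym

data Rule : Seq → Seq → Set where
  lλ : Rule (l ∷ lam ∷ []) (rho ∷ [])
  rλ : Rule (r ∷ lam ∷ []) []
  λr : Rule (lam ∷ r ∷ []) []
  ρr : Rule (rho ∷ r ∷ []) (l ∷ [])
  nn : Rule (n ∷ n ∷ []) []

data _⇝′_ : Seq → Seq → Set where
  step : ∀ x {u v} y → Rule u v → (x ++ u ++ y) ⇝′ (x ++ v ++ y)

_⇝_ : Seq → Seq → Set
_⇝_ = Star _⇝′_

Reduced : Seq → Set
Reduced z = ∀ {z′} → ¬ (z ⇝′ z′)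

-- "u = red(z)": u is a reduced sequence with z ⇝ u
IsRed : Seq → Seq → Set
IsRed z u = (z ⇝ u) × Reduced u

{-# OPTIONS --safe #-}
module Submission where

-- Reading a word from the right and pushing each letter onto an already reduced
-- stack (contracting at most one redex at the top) computes a normal form nf.
-- Each rewrite step preserves nf; the only interesting cases are the overlaps
-- l λ r, ρ r λ, r λ r, λ r λ and n n n. Hence red z = nf z, and z ≈ z′ defined
-- by nf z ≡ nf z′ is a congruence. Every letter is right-cancellable modulo ≈:
-- r, λ and n have right inverses, l is never the right letter of a redex (so
-- nf (a l) = nf a l), and ρ r = l reduces ρ to l. Cancelling w letter by letter
-- gives z₁ ≈ z₂, and appending y on both sides gives the claim.

open import Defs
open import Data.List using ([]; _∷_; _++_; [_]; _∷ʳ_; foldr; last)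
open import Data.List.Properties using (++-assoc; ++-identityʳ; ∷ʳ-++; ∷ʳ-injectiveˡ; foldr-++)
open import Data.List.Relation.Unary.Linked using (Linked; []; [-]; _∷_; tail)
open import Data.List.Relation.Unary.Linked.Properties using (++⁺)
open import Data.Maybe using (just; nothing)
open import Data.Maybe.Relation.Binary.Connected using (Connected; just; nothing-just)
open import Data.Product using (∃-syntax; _,_)
open import Data.Empty using (⊥-elim)
open import Function using (_∘_; _on_)
open import Relation.Binary.Construct.Closure.ReflexiveTransitive using (ε; _◅_; _◅◅_; gmap; return)
open import Relation.Binary.PropositionalEquality using (_≡_; refl; sym; trans; cong; subst₂; module ≡-Reasoning)
open import Relation.Nullary using (¬_; Dec; yes; no; contradiction)

private
  variable
    s t c : Sym
    a b u v w z z′ : Seq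

open ≡-Reasoning

Redex : Sym → Sym → Set
Redex s t = ∃[ q ] Rule (s ∷ t ∷ []) q

redex? : ∀ s t → Dec (Redex s t)
redex? l   lam = yes (_ , lλ)
redex? r   lam = yes (_ , rλ)
redex? lam r   = yes (_ , λr)
redex? rho r   = yes (_ , ρr)
redex? n   n   = yes (_ , nn)
redex? l   l   = no λ { (_ , ()) }
redex? l   r   = no λ { (_ , ()) }
redex? l   rho = no λ { (_ , ()) }
redex? l   n   = no λ { (_ , ()) }
redex? r   l   = no λ { (_ , ()) }
redex? r   r   = no λ { (_ , ()) }
redex? r   rho = no λ { (_ , ()) }
redex? r   n   = no λ { (_ , ()) }
redex? lam l   = no λ { (_ , ()) }
redex? lam lam = no λ { (_ , ()) }
redex? lam rho = no λ { (_ , ()) }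
redex? lam n   = no λ { (_ , ()) }
redex? rho l   = no λ { (_ , ()) }
redex? rho lam = no λ { (_ , ()) }
redex? rho rho = no λ { (_ , ()) }
redex? rho n   = no λ { (_ , ()) }
redex? n   l   = no λ { (_ , ()) }
redex? n   r   = no λ { (_ , ()) }
redex? n   lam = no λ { (_ , ()) }
redex? n   rho = no λ { (_ , ()) }

Irreducible : Sym → Sym → Set
Irreducible s t = ¬ Redex s t

Normal : Seq → Set
Normal = Linked Irreducible

redex⇒¬Normal : ∀ x {u v} y → Rule u v → ¬ Normal (x ++ u ++ y)
redex⇒¬Normal []      y lλ      (¬st ∷ _) = ¬st (_ , lλ)
redex⇒¬Normal []      y rλ      (¬st ∷ _) = ¬st (_ , rλ)
redex⇒¬Normal []      y λr      (¬st ∷ _) = ¬st (_ , λr)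
redex⇒¬Normal []      y ρr      (¬st ∷ _) = ¬st (_ , ρr)
redex⇒¬Normal []      y nn      (¬st ∷ _) = ¬st (_ , nn)
redex⇒¬Normal (c ∷ x) y rule    normal    = redex⇒¬Normal x y rule (tail normal)

Normal⇒Reduced : Normal u → Reduced u
Normal⇒Reduced normal (step x y rule) = redex⇒¬Normal x y rule normal

-- The one-letter contracta ρ of l λ and l of ρ r satisfy ρ ⊑ λ and l ⊑ r, so
-- contracting at the top of a normal stack keeps it normal.
_⊑_ : Sym → Sym → Set
c ⊑ t = ∀ {u} → Redex c u → Redex t u

rho⊑lam : rho ⊑ lam
rho⊑lam (_ , ρr) = _ , λr

l⊑r : l ⊑ r
l⊑r (_ , lλ) = _ , rλ

Normal-⊑-head : c ⊑ t → Normal (t ∷ v) → Normal (c ∷ v)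
Normal-⊑-head c⊑t [-]          = [-]
Normal-⊑-head c⊑t (¬tu ∷ rest) = ¬tu ∘ c⊑t ∷ rest

Normal-∷ʳ : (∀ {s} → Irreducible s t) → Normal u → Normal (u ∷ʳ t)
Normal-∷ʳ {t} {u} ¬redex normal = ++⁺ normal (connected (last u)) [-]
  where
  connected : ∀ m → Connected Irreducible m (just t)
  connected nothing  = nothing-just
  connected (just s) = just ¬redex

push : Sym → Seq → Seq
push s []      = [ s ]
push s (t ∷ v) with redex? s t
... | yes (q , _) = q ++ v
... | no _        = s ∷ t ∷ v

push-⇝ : ∀ s v → (s ∷ v) ⇝ push s v
push-⇝ s []      = ε
push-⇝ s (t ∷ v) with redex? s t
... | yes (_ , rule) = return (step [] v rule)
... | no _           = ε

Normal⇒push≡∷ : Normal (s ∷ v) → push s v ≡ s ∷ v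
Normal⇒push≡∷ {v = []}    _         = refl
Normal⇒push≡∷ {s} {t ∷ v} (¬st ∷ _) with redex? s t
... | yes st = contradiction st ¬st
... | no _   = refl

Normal-push : ∀ s {v} → Normal v → Normal (push s v)
Normal-push s {[]}    _      = [-]
Normal-push s {t ∷ v} normal with redex? s t
... | no ¬st       = ¬st ∷ normal
... | yes (_ , lλ) = Normal-⊑-head rho⊑lam normal
... | yes (_ , rλ) = tail normal
... | yes (_ , λr) = tail normal
... | yes (_ , ρr) = Normal-⊑-head l⊑r normal
... | yes (_ , nn) = tail normal

push-Rule : Rule u v → Normal w → foldr push w u ≡ foldr push w v
push-Rule {w = []} lλ _ = refl
push-Rule {w = []} rλ _ = refl
push-Rule {w = []} λr _ = refl
push-Rule {w = []} ρr _ = refl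
push-Rule {w = []} nn _ = refl
push-Rule {w = t ∷ w} lλ normal with redex? lam t
... | yes (_ , λr) = Normal⇒push≡∷ (Normal-⊑-head l⊑r normal)
... | no ¬λt       = sym (Normal⇒push≡∷ (Normal-⊑-head rho⊑lam (¬λt ∷ normal)))
push-Rule {w = t ∷ w} rλ normal with redex? lam t
... | yes (_ , λr) = Normal⇒push≡∷ normal
... | no _         = refl
push-Rule {w = t ∷ w} λr normal with redex? r t
... | yes (_ , rλ) = Normal⇒push≡∷ normal
... | no _         = refl
push-Rule {w = t ∷ w} ρr normal with redex? r t
... | yes (_ , rλ) = Normal⇒push≡∷ (Normal-⊑-head rho⊑lam normal)
... | no ¬rt       = sym (Normal⇒push≡∷ (Normal-⊑-head l⊑r (¬rt ∷ normal)))
push-Rule {w = t ∷ w} nn normal with redex? n t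
... | yes (_ , nn) = Normal⇒push≡∷ normal
... | no _         = refl

nf : Seq → Seq
nf = foldr push []

Normal-nf : ∀ z → Normal (nf z)
Normal-nf []      = []
Normal-nf (s ∷ z) = Normal-push s (Normal-nf z)

nf-++ : ∀ x y → nf (x ++ y) ≡ foldr push (nf y) x
nf-++ = foldr-++ push []

⇝-∷ : ∀ c → z ⇝ z′ → (c ∷ z) ⇝ (c ∷ z′)
⇝-∷ c = gmap (c ∷_) λ { (step x y rule) → step (c ∷ x) y rule }

⇝-++ʳ : ∀ w → z ⇝ z′ → (z ++ w) ⇝ (z′ ++ w)
⇝-++ʳ w = gmap (_++ w) λ { (step x {u} {v} y rule) →
  subst₂ _⇝′_ (sym (reassoc x u y)) (sym (reassoc x v y)) (step x (y ++ w) rule) }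
  where
  reassoc : ∀ x u y → (x ++ u ++ y) ++ w ≡ x ++ u ++ y ++ w
  reassoc x u y = trans (++-assoc x (u ++ y) w) (cong (x ++_) (++-assoc u y w))

⇝-nf : ∀ z → z ⇝ nf z
⇝-nf []      = ε
⇝-nf (s ∷ z) = ⇝-∷ s (⇝-nf z) ◅◅ push-⇝ s (nf z)

Reduced-⇝ : Reduced u → u ⇝ v → u ≡ v
Reduced-⇝ _       ε       = refl
Reduced-⇝ reduced (st ◅ _) = ⊥-elim (reduced st)

infix 4 _≈_

_≈_ : Seq → Seq → Set
_≈_ = _≡_ on nf

≈-cong-++ˡ : ∀ x → u ≈ v → x ++ u ≈ x ++ v
≈-cong-++ˡ []      u≈v = u≈v
≈-cong-++ˡ (c ∷ x) u≈v = cong (push c) (≈-cong-++ˡ x u≈v)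

⇝′⇒≈ : z ⇝′ z′ → z ≈ z′
⇝′⇒≈ (step x {u} {v} y rule) = ≈-cong-++ˡ x (begin
  nf (u ++ y)          ≡⟨ nf-++ u y ⟩
  foldr push (nf y) u  ≡⟨ push-Rule rule (Normal-nf y) ⟩
  foldr push (nf y) v  ≡⟨ nf-++ v y ⟨
  nf (v ++ y)          ∎)

⇝⇒≈ : z ⇝ z′ → z ≈ z′
⇝⇒≈ ε          = refl
⇝⇒≈ (st ◅ sts) = trans (⇝′⇒≈ st) (⇝⇒≈ sts)

IsRed-nf : ∀ z → IsRed z (nf z)
IsRed-nf z = ⇝-nf z , Normal⇒Reduced (Normal-nf z)

IsRed⇒≡nf : IsRed z u → u ≡ nf z
IsRed⇒≡nf {u = u} (z⇝u , reduced) = trans (Reduced-⇝ reduced (⇝-nf u)) (sym (⇝⇒≈ z⇝u))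

≈-cong-++ʳ : ∀ x u v → u ≈ v → u ++ x ≈ v ++ x
≈-cong-++ʳ x u v u≈v = begin
  nf (u ++ x)     ≡⟨ ⇝⇒≈ (⇝-++ʳ x (⇝-nf u)) ⟩
  nf (nf u ++ x)  ≡⟨ cong (λ w → nf (w ++ x)) u≈v ⟩
  nf (nf v ++ x)  ≡⟨ ⇝⇒≈ (⇝-++ʳ x (⇝-nf v)) ⟨
  nf (v ++ x)     ∎

contract-∷ʳ : ∀ {q} → Rule (s ∷ t ∷ []) q → ∀ a → (a ∷ʳ s) ∷ʳ t ≈ a ++ q
contract-∷ʳ {s} {t} rule a =
  trans (cong nf (++-assoc a [ s ] [ t ])) (≈-cong-++ˡ a (push-Rule rule []))

∷ʳ-cancel-by-contraction : ∀ {q} → Rule (s ∷ t ∷ []) q →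
  (∀ a b → a ++ q ≈ b ++ q → a ≈ b) → ∀ a b → a ∷ʳ s ≈ b ∷ʳ s → a ≈ b
∷ʳ-cancel-by-contraction {s} {t} {q} rule cancel-q a b as≈bs = cancel-q a b (begin
  nf (a ++ q)         ≡⟨ contract-∷ʳ rule a ⟨
  nf ((a ∷ʳ s) ∷ʳ t)  ≡⟨ ≈-cong-++ʳ [ t ] (a ∷ʳ s) (b ∷ʳ s) as≈bs ⟩
  nf ((b ∷ʳ s) ∷ʳ t)  ≡⟨ contract-∷ʳ rule b ⟩
  nf (b ++ q)         ∎)

++[]-cancel-≈ : ∀ a b → a ++ [] ≈ b ++ [] → a ≈ b
++[]-cancel-≈ a b = subst₂ _≈_ (++-identityʳ a) (++-identityʳ b)

nf-∷ʳ-l : ∀ a → nf (a ∷ʳ l) ≡ nf a ∷ʳ l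
nf-∷ʳ-l a = sym (IsRed⇒≡nf (⇝-++ʳ [ l ] (⇝-nf a) ,
                            Normal⇒Reduced (Normal-∷ʳ (λ { (_ , ()) }) (Normal-nf a))))

∷ʳ-l-cancel-≈ : ∀ a b → a ∷ʳ l ≈ b ∷ʳ l → a ≈ b
∷ʳ-l-cancel-≈ a b al≈bl =
  ∷ʳ-injectiveˡ (nf a) (nf b) (trans (sym (nf-∷ʳ-l a)) (trans al≈bl (nf-∷ʳ-l b)))

∷ʳ-cancel-≈ : ∀ s a b → a ∷ʳ s ≈ b ∷ʳ s → a ≈ b
∷ʳ-cancel-≈ l   = ∷ʳ-l-cancel-≈
∷ʳ-cancel-≈ r   = ∷ʳ-cancel-by-contraction rλ ++[]-cancel-≈
∷ʳ-cancel-≈ lam = ∷ʳ-cancel-by-contraction λr ++[]-cancel-≈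
∷ʳ-cancel-≈ rho = ∷ʳ-cancel-by-contraction ρr ∷ʳ-l-cancel-≈
∷ʳ-cancel-≈ n   = ∷ʳ-cancel-by-contraction nn ++[]-cancel-≈

++-cancelʳ-≈ : ∀ w a b → a ++ w ≈ b ++ w → a ≈ b
++-cancelʳ-≈ []      = ++[]-cancel-≈
++-cancelʳ-≈ (s ∷ w) a b aw≈bw = ∷ʳ-cancel-≈ s a b
  (++-cancelʳ-≈ w (a ∷ʳ s) (b ∷ʳ s) (subst₂ _≈_ (sym (∷ʳ-++ a s w)) (sym (∷ʳ-++ b s w)) aw≈bw))

corollary27 : ∀ (z₁ z₂ w : Seq) →
    (∀ u₁ u₂ → IsRed (z₁ ++ w) u₁ → IsRed (z₂ ++ w) u₂ → u₁ ≡ u₂) →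
    ∀ (y : Seq) → ∀ v₁ v₂ → IsRed (z₁ ++ y) v₁ → IsRed (z₂ ++ y) v₂ → v₁ ≡ v₂
corollary27 z₁ z₂ w same-red y v₁ v₂ red₁ red₂ = begin
  v₁            ≡⟨ IsRed⇒≡nf red₁ ⟩
  nf (z₁ ++ y)  ≡⟨ ≈-cong-++ʳ y z₁ z₂ z₁≈z₂ ⟩
  nf (z₂ ++ y)  ≡⟨ IsRed⇒≡nf red₂ ⟨
  v₂            ∎
  where
  z₁≈z₂ : z₁ ≈ z₂
  z₁≈z₂ = ++-cancelʳ-≈ w z₁ z₂ (same-red _ _ (IsRed-nf (z₁ ++ w)) (IsRed-nf (z₂ ++ w)))
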